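{- Let $\alpha$ be a PDL program, $\ell\subseteq\mathit{Tests}(\alpha)$, and $\bar\delta\in P^\ell(\alpha)$. Then: (a) if $\alpha=a$ is atomic then $\bar\delta=a$; (b) if $\alpha=\beta^\ast$ for some $\beta$, then either $\bar\delta=\varepsilon$ or $\bar\delta=a\delta_1\cdots\delta_n\beta^\ast$ with $n\ge0$, $a$ atomic and each $\delta_i\in\mathit{Progs}(\alpha)\setminus\{\alpha\}$; (c) otherwise, either $\bar\delta=\varepsilon$ or $\bar\delta=a\delta_1\cdots\delta_n$ with $n\ge0$, $a$ atomic and each $\delta_i\in\mathit{Progs}(\alpha)\setminus\{\alpha\}$.
   Context: PDL programs $\alpha ::= a \mid \tau? \mid \alpha\cup\beta \mid \alpha;\beta \mid \alpha^\ast$ ($a$ atomic, $\tau$ a PDL formula). Lists of programs are written by juxtaposition (concatenation), $\varepsilon$ the empty list. Shallow tests: $\mathit{Tests}(a)=\emptyset$, $\mathit{Tests}(\tau?)=\{\tau\}$, $\mathit{Tests}(\alpha\cup\beta)=\mathit{Tests}(\alpha;\beta)=\mathit{Tests}(\alpha)\cup\mathit{Tests}(\beta)$, $\mathit{Tests}(\alpha^\ast)=\mathit{Tests}(\alpha)$. Shallow subprograms: $\mathit{Progs}(a)=\{a\}$, $\mathit{Progs}(\tau?)=\{\tau?\}$, $\mathit{Progs}(\alpha\cup\beta)=\{\alpha\cup\beta\}\cup\mathit{Progs}(\alpha)\cup\mathit{Progs}(\beta)$, $\mathit{Progs}(\alpha;\beta)=\{\alpha;\beta\}\cup\mathit{Progs}(\alpha)\cup\mathit{Progs}(\beta)$,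 $\mathit{Progs}(\alpha^\ast)=\{\alpha^\ast\}\cup\mathit{Progs}(\alpha)$. For a set $\ell$ of formulas: $P^\ell(a)=\{a\}$; $P^\ell(\tau?)=\{\varepsilon\}$ if $\tau\in\ell$ else $\emptyset$; $P^\ell(\beta\cup\gamma)=P^\ell(\beta)\cup P^\ell(\gamma)$; $P^\ell(\beta;\gamma)=\{\bar\beta\gamma\mid\bar\beta\in P^\ell(\beta)\setminus\{\varepsilon\}\}\cup\{\bar\gamma\mid\bar\gamma\in P^\ell(\gamma),\varepsilon\in P^\ell(\beta)\}$; $P^\ell(\beta^\ast)=\{\varepsilon\}\cup\{\bar\beta\beta^\ast\mid\bar\beta\in P^\ell(\beta)\setminus\{\varepsilon\}\}$. -}

module Defs where

open import Data.Nat using (ℕ)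
open import Data.List using (List; []; _∷_; _++_)
open import Data.Empty using (⊥)
open import Data.Unit using (⊤)
open import Data.Sum using (_⊎_)
open import Data.Product using (Σ; _×_; ∃-syntax)
open import Relation.Binary.PropositionalEquality using (_≡_)
open import Relation.Nullary using (¬_)

mutual
  data Form : Set where
    ⊥f   : Form
    var  : ℕ → Form
    ¬f_  : Form → Form
    _∧f_ : Form → Form → Form
    [_]_ : Prog → Form → Form

  data Prog : Set where
    atom : ℕ → Prog
    _¿   : Form → Prog
    _∪_  : Prog → Prog → Prog
    _⨾_  : Prog → Prog → Prog
    _⋆   : Prog → Prog

FormSet : Set₁
FormSet = Form → Set

Tests : Prog → FormSet
Tests (atom a) τ = ⊥
Tests (σ ¿) τ = τ ≡ σ
Tests (α ∪ β) τ = Tests α τ ⊎ Tests β τ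
Tests (α ⨾ β) τ = Tests α τ ⊎ Tests β τ
Tests (α ⋆) τ = Tests α τ

Progs : Prog → Prog → Set
Progs (atom a) δ = δ ≡ atom a
Progs (σ ¿) δ = δ ≡ σ ¿
Progs (α ∪ β) δ = δ ≡ (α ∪ β) ⊎ Progs α δ ⊎ Progs β δ
Progs (α ⨾ β) δ = δ ≡ (α ⨾ β) ⊎ Progs α δ ⊎ Progs β δ
Progs (α ⋆) δ = δ ≡ (α ⋆) ⊎ Progs α δ

_⊆Tests_ : FormSet → Prog → Set
ℓ ⊆Tests α = ∀ τ → ℓ τ → Tests α τ

-- Membership δ̄ ∈ P^ℓ(α), where δ̄ is a list of programs (ε = []).
P : FormSet → Prog → List Prog → Set
P ℓ (atom a) δs = δs ≡ atom a ∷ []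
P ℓ (τ ¿) δs = ℓ τ × δs ≡ []
P ℓ (β ∪ γ) δs = P ℓ β δs ⊎ P ℓ γ δs
P ℓ (β ⨾ γ) δs =
  (∃[ bs ] (P ℓ β bs × ¬ bs ≡ [] × δs ≡ bs ++ (γ ∷ [])))
  ⊎ (P ℓ γ δs × P ℓ β [])
P ℓ (β ⋆) δs =
  δs ≡ [] ⊎ (∃[ bs ] (P ℓ β bs × ¬ bs ≡ [] × δs ≡ bs ++ ((β ⋆) ∷ [])))

IsStar : Prog → Set
IsStar (β ⋆) = ⊤
IsStar _ = ⊥

IsAtom : Prog → Set
IsAtom (atom a) = ⊤
IsAtom _ = ⊥

ProperProg : Prog → Prog → Set
ProperProg α δ = Progs α δ × ¬ δ ≡ α

{-# OPTIONS --safe #-}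
module Submission where

open import Defs
open import Data.List using (List; []; _∷_; _++_)
open import Data.List.Relation.Unary.All using (All; []; _∷_)
import Data.List.Relation.Unary.All as All
open import Data.List.Relation.Unary.All.Properties using (++⁺)
open import Data.Nat using (ℕ; suc; _+_; _≤_; _<_; s≤s)
open import Data.Nat.Properties using (≤-refl; ≤-trans; m≤m+n; m≤n+m; m≤n⇒m≤1+n; <-irrefl; ≤-<-trans)
open import Data.Sum using (_⊎_; inj₁; inj₂)
open import Data.Product using (_×_; ∃-syntax; _,_; proj₁)
open import Data.Empty using (⊥-elim)
open import Relation.Binary.PropositionalEquality using (_≡_; refl)
open import Relation.Nullary using (¬_)

-- By induction on α, every nonempty δ̄ ∈ P^ℓ(α) is an atomic program followed
-- by shallow subprograms of α, where α itself can only occur as the closing β*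
-- of a star. In the other cases the tail consists of subprograms of the
-- immediate components, which are proper because they are smaller than α.

size : Prog → ℕ
size (atom _) = 1
size (_ ¿)    = 1
size (β ∪ γ)  = suc (size β + size γ)
size (β ⨾ γ)  = suc (size β + size γ)
size (β ⋆)    = suc (size β)

Progs-refl : ∀ α → Progs α α
Progs-refl (atom _) = refl
Progs-refl (_ ¿)    = refl
Progs-refl (_ ∪ _)  = inj₁ refl
Progs-refl (_ ⨾ _)  = inj₁ refl
Progs-refl (_ ⋆)    = inj₁ refl

Progs-size≤ : ∀ α {δ} → Progs α δ → size δ ≤ size α
Progs-size≤ (atom _) refl = ≤-refl
Progs-size≤ (_ ¿)    refl = ≤-refl
Progs-size≤ (β ∪ γ) (inj₁ refl)     = ≤-refl
Progs-size≤ (β ∪ γ) (inj₂ (inj₁ p)) = m≤n⇒m≤1+n (≤-trans (Progs-size≤ β p) (m≤m+n _ _))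
Progs-size≤ (β ∪ γ) (inj₂ (inj₂ p)) = m≤n⇒m≤1+n (≤-trans (Progs-size≤ γ p) (m≤n+m _ _))
Progs-size≤ (β ⨾ γ) (inj₁ refl)     = ≤-refl
Progs-size≤ (β ⨾ γ) (inj₂ (inj₁ p)) = m≤n⇒m≤1+n (≤-trans (Progs-size≤ β p) (m≤m+n _ _))
Progs-size≤ (β ⨾ γ) (inj₂ (inj₂ p)) = m≤n⇒m≤1+n (≤-trans (Progs-size≤ γ p) (m≤n+m _ _))
Progs-size≤ (β ⋆) (inj₁ refl) = ≤-refl
Progs-size≤ (β ⋆) (inj₂ p)    = m≤n⇒m≤1+n (Progs-size≤ β p)

smaller-Progs⇒ProperProg : ∀ {α β δ} → size β < size α → Progs β δ → Progs α δ → ProperProg α δ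
smaller-Progs⇒ProperProg {β = β} β<α δ∈β δ∈α =
  δ∈α , λ { refl → <-irrefl refl (≤-<-trans (Progs-size≤ β δ∈β) β<α) }

∪ˡ-ProperProg : ∀ {β γ δ} → Progs β δ → ProperProg (β ∪ γ) δ
∪ˡ-ProperProg p = smaller-Progs⇒ProperProg (s≤s (m≤m+n _ _)) p (inj₂ (inj₁ p))

∪ʳ-ProperProg : ∀ {β γ δ} → Progs γ δ → ProperProg (β ∪ γ) δ
∪ʳ-ProperProg p = smaller-Progs⇒ProperProg (s≤s (m≤n+m _ _)) p (inj₂ (inj₂ p))

⨾ˡ-ProperProg : ∀ {β γ δ} → Progs β δ → ProperProg (β ⨾ γ) δ
⨾ˡ-ProperProg p = smaller-Progs⇒ProperProg (s≤s (m≤m+n _ _)) p (inj₂ (inj₁ p))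

⨾ʳ-ProperProg : ∀ {β γ δ} → Progs γ δ → ProperProg (β ⨾ γ) δ
⨾ʳ-ProperProg p = smaller-Progs⇒ProperProg (s≤s (m≤n+m _ _)) p (inj₂ (inj₂ p))

⋆-ProperProg : ∀ {β δ} → Progs β δ → ProperProg (β ⋆) δ
⋆-ProperProg p = smaller-Progs⇒ProperProg ≤-refl p (inj₂ p)

Word⁺ : (Prog → Set) → List Prog → Set
Word⁺ R δs = ∃[ a ] ∃[ ds ] (All R ds × δs ≡ atom a ∷ ds)

Word : (Prog → Set) → List Prog → Set
Word R δs = δs ≡ [] ⊎ Word⁺ R δs

StarWord : (Prog → Set) → Prog → List Prog → Set
StarWord R β δs = δs ≡ [] ⊎ (∃[ a ] ∃[ ds ] (All R ds × δs ≡ atom a ∷ (ds ++ ((β ⋆) ∷ []))))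

module _ {R S : Prog → Set} (R⊆S : ∀ {δ} → R δ → S δ) where

  Word⁺-map : ∀ {δs} → Word⁺ R δs → Word⁺ S δs
  Word⁺-map (a , ds , rs , eq) = a , ds , All.map R⊆S rs , eq

  Word-map : ∀ {δs} → Word R δs → Word S δs
  Word-map (inj₁ eq) = inj₁ eq
  Word-map (inj₂ w)  = inj₂ (Word⁺-map w)

  StarWord⇒Word : ∀ {β δs} → S (β ⋆) → StarWord R β δs → Word S δs
  StarWord⇒Word s (inj₁ eq) = inj₁ eq
  StarWord⇒Word s (inj₂ (a , ds , rs , refl)) =
    inj₂ (a , ds ++ _ ∷ [] , ++⁺ (All.map R⊆S rs) (s ∷ []) , refl)

Word⇒Word⁺ : ∀ {R δs} → Word R δs → ¬ δs ≡ [] → Word⁺ R δs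
Word⇒Word⁺ (inj₁ eq) δs≢[] = ⊥-elim (δs≢[] eq)
Word⇒Word⁺ (inj₂ w)  _     = w

Word⁺-snoc : ∀ {R δs γ} → Word⁺ R δs → R γ → Word⁺ R (δs ++ γ ∷ [])
Word⁺-snoc (a , ds , rs , refl) r = a , ds ++ _ ∷ [] , ++⁺ rs (r ∷ []) , refl

module _ {ℓ : FormSet} where

  mutual
    P⇒Word : ∀ α {δs} → P ℓ α δs → Word (Progs α) δs
    P⇒Word (atom a) p = Word-map proj₁ (P⇒ProperWord (atom a) (λ ()) p)
    P⇒Word (τ ¿)    p = Word-map proj₁ (P⇒ProperWord (τ ¿) (λ ()) p)
    P⇒Word (β ∪ γ)  p = Word-map proj₁ (P⇒ProperWord (β ∪ γ) (λ ()) p)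
    P⇒Word (β ⨾ γ)  p = Word-map proj₁ (P⇒ProperWord (β ⨾ γ) (λ ()) p)
    P⇒Word (β ⋆)    p = StarWord⇒Word proj₁ (Progs-refl (β ⋆)) (P⋆⇒StarWord β p)

    P⋆⇒StarWord : ∀ β {δs} → P ℓ (β ⋆) δs → StarWord (ProperProg (β ⋆)) β δs
    P⋆⇒StarWord β (inj₁ eq) = inj₁ eq
    P⋆⇒StarWord β (inj₂ (bs , p , bs≢[] , refl))
      with Word⁺-map ⋆-ProperProg (Word⇒Word⁺ (P⇒Word β p) bs≢[])
    ... | a , ds , rs , refl = inj₂ (a , ds , rs , refl)

    P⇒ProperWord : ∀ α {δs} → ¬ IsStar α → P ℓ α δs → Word (ProperProg α) δs
    P⇒ProperWord (atom a) _ p = inj₂ (a , [] , [] , p)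
    P⇒ProperWord (τ ¿)    _ (_ , p) = inj₁ p
    P⇒ProperWord (β ∪ γ)  _ (inj₁ p) = Word-map ∪ˡ-ProperProg (P⇒Word β p)
    P⇒ProperWord (β ∪ γ)  _ (inj₂ p) = Word-map ∪ʳ-ProperProg (P⇒Word γ p)
    P⇒ProperWord (β ⨾ γ)  _ (inj₁ (bs , p , bs≢[] , refl)) =
      inj₂ (Word⁺-snoc (Word⁺-map ⨾ˡ-ProperProg (Word⇒Word⁺ (P⇒Word β p) bs≢[]))
                       (⨾ʳ-ProperProg (Progs-refl γ)))
    P⇒ProperWord (β ⨾ γ)  _ (inj₂ (p , _)) = Word-map ⨾ʳ-ProperProg (P⇒Word γ p)
    P⇒ProperWord (β ⋆) ¬star _ = ⊥-elim (¬star _)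

lemma3p7 : (α : Prog) (ℓ : FormSet) → ℓ ⊆Tests α → (δ̄ : List Prog) → P ℓ α δ̄ →
    ((a : ℕ) → α ≡ atom a → δ̄ ≡ atom a ∷ [])
    × ((β : Prog) → α ≡ (β ⋆) →
        δ̄ ≡ [] ⊎ (∃[ a ] ∃[ ds ] (All (ProperProg α) ds × δ̄ ≡ atom a ∷ (ds ++ ((β ⋆) ∷ [])))))
    × (¬ IsAtom α → ¬ IsStar α →
        δ̄ ≡ [] ⊎ (∃[ a ] ∃[ ds ] (All (ProperProg α) ds × δ̄ ≡ atom a ∷ ds)))
lemma3p7 α ℓ _ δ̄ p =
    (λ { a refl → p })
  , (λ { β refl → P⋆⇒StarWord β p })
  , (λ _ ¬star → P⇒ProperWord α ¬star p)
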